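{- Let $\alpha,\beta$ be nonzero integers. There exist integers $m,n$ with $|\alpha^3+\alpha^2\beta m-\alpha\beta^2 n+\beta^3|=1$ if and only if either ($\beta$ divides $\alpha^3-1$ and $\alpha$ divides $\beta^3-1$) or ($\beta$ divides $\alpha^3+1$ and $\alpha$ divides $\beta^3+1$).
   Context: The expression $\alpha^3+\alpha^2\beta m-\alpha\beta^2 n+\beta^3$ equals the determinant of $\alpha I+\beta A_{m,n}^{ -1}$, where $A_{m,n}=\begin{pmatrix}0&1&0\\0&0&1\\1&-m&-n\end{pmatrix}$. -}

module Defs where

module Submission where

open import Defs
open import Data.Integer using (ℤ; _+_; _-_; _*_; _^_; ∣_∣; 1ℤ; 0ℤ)
open import Data.Integer.Divisibility using (_∣_)
open import Data.Nat using (ℕ)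
open import Data.Product using (∃₂; _×_)
open import Data.Sum using (_⊎_)
open import Relation.Binary.PropositionalEquality using (_≡_; _≢_)
open import Function.Bundles using (_⇔_)

open import Data.Integer using (+_; -[1+_]; -_; -1ℤ)
open import Data.Integer.Properties using (+-assoc; *-identityʳ)
import Data.Integer.Divisibility.Signed as Signed
open Signed using (divides; ∣-refl; ∣m⇒∣m*n; ∣m∣n⇒∣m+n; ∣ᵤ⇒∣; ∣⇒∣ᵤ)
  renaming (_∣_ to _∣ₛ_)
open import Data.Integer.Solver using (module +-*-Solver)
open import Data.Integer.Tactic.RingSolver using (solve)
open import Data.List using ([]; _∷_)
open import Data.Product using (_,_)
open import Data.Sum using (inj₁; inj₂; [_,_]′) renaming (map to ⊎-map)
open import Function.Bundles using (mk⇔)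
open import Relation.Binary.PropositionalEquality
  using (refl; sym; trans; cong; cong₂; subst; module ≡-Reasoning)

-- Write F(m, n) = α³ + α²βm − αβ²n + β³.  Since F(m, n) = α³ + β³ + αβ(αm − βn),
-- F is congruent to α³ modulo β and to β³ modulo α.
--
-- (⇒) If F(m, n) = ε with ε = ±1, reducing modulo β and modulo α gives
--     β ∣ α³ − ε and α ∣ β³ − ε.
-- (⇐) Conversely, α³ − ε = aβ yields the Bézout relation (εα²)α − (εa)β = 1, so
--     α and β are coprime.  Both divide N = α³ + β³ − ε, hence so does αβ,
--     say N = kαβ; choosing m, n with αm − βn = −k (possible by Bézout) gives
--     F(m, n) = N − kαβ + ε = ε.
-- The theorem follows by splitting |F(m, n)| = 1 into F(m, n) = 1 or −1.

∣x∣≡1⇒x≡±1 : ∀ {x : ℤ} → ∣ x ∣ ≡ 1 → x ≡ 1ℤ ⊎ x ≡ -1ℤ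
∣x∣≡1⇒x≡±1 { + .1 }     refl = inj₁ refl
∣x∣≡1⇒x≡±1 { -[1+ 0 ] } refl = inj₂ refl

divides-difference : ∀ c q d {x ε : ℤ} → x ≡ c + q * d → x ≡ ε → d ∣ₛ (c - ε)
divides-difference c q d {x} {ε} x≡c+qd x≡ε = divides (- q) (begin
  c - ε             ≡⟨ cong (λ z → c - z) (trans (sym x≡ε) x≡c+qd) ⟩
  c - (c + q * d)   ≡⟨ solve (c ∷ q ∷ d ∷ []) ⟩
  - q * d           ∎)
  where open ≡-Reasoning

unit-congruence⇒bezout : ∀ {x w d ε : ℤ} → ε * ε ≡ 1ℤ → d ∣ₛ (x * w - ε) →
  ∃₂ λ (u v : ℤ) → u * x + v * d ≡ 1ℤ
unit-congruence⇒bezout {x} {w} {d} {ε} ε²≡1 (divides q xw-ε≡qd) =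
  ε * w , - (ε * q) , (begin
    ε * w * x + - (ε * q) * d   ≡⟨ solve (ε ∷ w ∷ x ∷ q ∷ d ∷ []) ⟩
    ε * (x * w - q * d)         ≡⟨ cong (λ z → ε * (x * w - z)) (sym xw-ε≡qd) ⟩
    ε * (x * w - (x * w - ε))   ≡⟨ solve (ε ∷ x ∷ w ∷ []) ⟩
    ε * ε                       ≡⟨ ε²≡1 ⟩
    1ℤ                          ∎)
  where open ≡-Reasoning

bezout⇒product-∣ : ∀ {u v x y N : ℤ} → u * x + v * y ≡ 1ℤ →
  x ∣ₛ N → y ∣ₛ N → (x * y) ∣ₛ N
bezout⇒product-∣ {u} {v} {x} {y} {N} bezout (divides p N≡px) (divides q N≡qy) =
  divides (u * q + v * p) (begin
    N                               ≡⟨ sym (*-identityʳ N) ⟩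
    N * 1ℤ                          ≡⟨ cong (N *_) (sym bezout) ⟩
    N * (u * x + v * y)             ≡⟨ solve (N ∷ u ∷ x ∷ v ∷ y ∷ []) ⟩
    u * x * N + v * y * N           ≡⟨ cong₂ (λ a b → u * x * a + v * y * b) N≡qy N≡px ⟩
    u * x * (q * y) + v * y * (p * x) ≡⟨ solve (u ∷ x ∷ q ∷ y ∷ v ∷ p ∷ []) ⟩
    (u * q + v * p) * (x * y)       ∎)
  where open ≡-Reasoning

bezout⇒solvable : ∀ {u v x y : ℤ} → u * x + v * y ≡ 1ℤ →
  ∀ t → ∃₂ λ (m n : ℤ) → x * m - y * n ≡ t
bezout⇒solvable {u} {v} {x} {y} bezout t = t * u , - (t * v) , (begin
  x * (t * u) - y * - (t * v)   ≡⟨ solve (x ∷ t ∷ u ∷ y ∷ v ∷ []) ⟩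
  t * (u * x + v * y)           ≡⟨ cong (t *_) bezout ⟩
  t * 1ℤ                        ≡⟨ *-identityʳ t ⟩
  t                             ∎)
  where open ≡-Reasoning

remove-multiple : ∀ {A p k ε : ℤ} → A - ε ≡ k * p → A + p * - k ≡ ε
remove-multiple {A} {p} {k} {ε} A-ε≡kp = begin
  A + p * - k             ≡⟨ solve (A ∷ p ∷ k ∷ ε ∷ []) ⟩
  ε + ((A - ε) - k * p)   ≡⟨ cong (λ z → ε + (z - k * p)) A-ε≡kp ⟩
  ε + (k * p - k * p)     ≡⟨ solve (ε ∷ k ∷ p ∷ []) ⟩
  ε                       ∎
  where open ≡-Reasoning

form : ℤ → ℤ → ℤ → ℤ → ℤ
form α β m n = α ^ 3 + α ^ 2 * β * m - α * β ^ 2 * n + β ^ 3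

open +-*-Solver using (_:+_; _:-_; _:*_; _:^_; _:=_)

form-decomposition : ∀ α β m n → form α β m n ≡ α ^ 3 + β ^ 3 + α * β * (α * m - β * n)
form-decomposition = +-*-Solver.solve 4 (λ α β m n →
  α :^ 3 :+ α :^ 2 :* β :* m :- α :* β :^ 2 :* n :+ β :^ 3
    := α :^ 3 :+ β :^ 3 :+ α :* β :* (α :* m :- β :* n)) refl

form-mod-β : ∀ α β m n → form α β m n ≡ α ^ 3 + (β ^ 2 + α * (α * m - β * n)) * β
form-mod-β = +-*-Solver.solve 4 (λ α β m n →
  α :^ 3 :+ α :^ 2 :* β :* m :- α :* β :^ 2 :* n :+ β :^ 3
    := α :^ 3 :+ (β :^ 2 :+ α :* (α :* m :- β :* n)) :* β) refl

form-mod-α : ∀ α β m n → form α β m n ≡ β ^ 3 + (α ^ 2 + β * (α * m - β * n)) * α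
form-mod-α = +-*-Solver.solve 4 (λ α β m n →
  α :^ 3 :+ α :^ 2 :* β :* m :- α :* β :^ 2 :* n :+ β :^ 3
    := β :^ 3 :+ (α :^ 2 :+ β :* (α :* m :- β :* n)) :* α) refl

form-value⇒divisibility : ∀ α β m n {ε : ℤ} → form α β m n ≡ ε →
  (β ∣ (α ^ 3 - ε)) × (α ∣ (β ^ 3 - ε))
form-value⇒divisibility α β m n F≡ε =
  ∣⇒∣ᵤ (divides-difference (α ^ 3) (β ^ 2 + α * (α * m - β * n)) β (form-mod-β α β m n) F≡ε) ,
  ∣⇒∣ᵤ (divides-difference (β ^ 3) (α ^ 2 + β * (α * m - β * n)) α (form-mod-α α β m n) F≡ε)

both-divide : ∀ α β {ε : ℤ} → β ∣ₛ (α ^ 3 - ε) → α ∣ₛ (β ^ 3 - ε) →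
  (α ∣ₛ (α ^ 3 + β ^ 3 - ε)) × (β ∣ₛ (α ^ 3 + β ^ 3 - ε))
both-divide α β {ε} β∣α³-ε α∣β³-ε =
  subst (α ∣ₛ_) (sym (+-assoc (α ^ 3) (β ^ 3) (- ε)))
    (∣m∣n⇒∣m+n (∣m⇒∣m*n (α ^ 2) ∣-refl) α∣β³-ε) ,
  subst (β ∣ₛ_) (+-*-Solver.solve 3 (λ α β ε →
      (α :^ 3 :- ε) :+ β :^ 3 := α :^ 3 :+ β :^ 3 :- ε) refl α β ε)
    (∣m∣n⇒∣m+n β∣α³-ε (∣m⇒∣m*n (β ^ 2) ∣-refl))

divisibility⇒form-value : ∀ α β {ε : ℤ} → ε * ε ≡ 1ℤ →
  (β ∣ (α ^ 3 - ε)) × (α ∣ (β ^ 3 - ε)) → ∃₂ λ (m n : ℤ) → form α β m n ≡ ε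
divisibility⇒form-value α β {ε} ε²≡1 (β∣α³-ε , α∣β³-ε)
  with u , v , bezout ← unit-congruence⇒bezout {x = α} {w = α ^ 2} ε²≡1 (∣ᵤ⇒∣ β∣α³-ε)
  with α∣N , β∣N ← both-divide α β (∣ᵤ⇒∣ β∣α³-ε) (∣ᵤ⇒∣ α∣β³-ε)
  with divides k N≡kαβ ← bezout⇒product-∣ {u} {v} {α} {β} bezout α∣N β∣N
  with m , n , αm-βn≡-k ← bezout⇒solvable {u} {v} {α} {β} bezout (- k)
  = m , n , (begin
    form α β m n                            ≡⟨ form-decomposition α β m n ⟩
    α ^ 3 + β ^ 3 + α * β * (α * m - β * n) ≡⟨ cong (λ t → α ^ 3 + β ^ 3 + α * β * t) αm-βn≡-k ⟩
    α ^ 3 + β ^ 3 + α * β * - k             ≡⟨ remove-multiple {α ^ 3 + β ^ 3} {α * β} N≡kαβ ⟩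
    ε                                       ∎)
  where open ≡-Reasoning

mainTheorem4 : (α β : ℤ) → α ≢ 0ℤ → β ≢ 0ℤ →
    ((∃₂ λ (m n : ℤ) → ∣ α ^ 3 + α ^ 2 * β * m - α * β ^ 2 * n + β ^ 3 ∣ ≡ 1)
    ⇔ (((β ∣ (α ^ 3 - 1ℤ)) × (α ∣ (β ^ 3 - 1ℤ))) ⊎ ((β ∣ (α ^ 3 + 1ℤ)) × (α ∣ (β ^ 3 + 1ℤ)))))
mainTheorem4 α β _ _ = mk⇔
  (λ { (m , n , ∣F∣≡1) →
    ⊎-map (form-value⇒divisibility α β m n) (form-value⇒divisibility α β m n)
          (∣x∣≡1⇒x≡±1 ∣F∣≡1) })
  [ (λ divisibility → attain 1ℤ refl (divisibility⇒form-value α β refl divisibility))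
  , (λ divisibility → attain -1ℤ refl (divisibility⇒form-value α β refl divisibility)) ]′
  where
  attain : ∀ ε → ∣ ε ∣ ≡ 1 → (∃₂ λ (m n : ℤ) → form α β m n ≡ ε) →
    ∃₂ λ (m n : ℤ) → ∣ form α β m n ∣ ≡ 1
  attain ε ∣ε∣≡1 (m , n , F≡ε) = m , n , trans (cong ∣_∣ F≡ε) ∣ε∣≡1
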